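{- Let $h, n \in \mathbb{N}$ where $n \geq 2^h$ is a power of $2$, and let $k=2^h$. For any nonempty $Q \subseteq \{0,1,\dots,n-1\}$, we have $|\mathsf{bin\text{ - }prof}_h(Q)| \leq |Q|-1$.
   Context: Every nonnegative integer $t$ has a binary representation $(b^t_1,b^t_2,\dots)$ with $t=\sum_j b^t_j 2^{j-1}$; for distinct nonnegative integers $x,y$, $M(x,y)$ is the largest index $i$ with $b^x_i\ne b^y_i$. For an $h$-tuple $(i_1,\dots,i_h)\in[\log_2 n]^h$ with $i_1<\dots<i_h$, a $k$-tuple $(x_1,\dots,x_k)$ with $x_1<\dots<x_k$ has binary $h$-profile of type $(i_1,\dots,i_h)$ if $M(x_j,x_{j+1})=i_{M(j-1,j)}$ for every $j\in[k-1]$ (here $M(j-1,j)\in[h]$ is computed on the integers $j-1,j$). Then $\mathsf{bin\text{ - }prof}_h(Q)$ is the set of all $(i_1,\dots,i_h)$ with $i_1<\dots<i_h$ in $[\log_2 n]$ such that some $x_1<\dots<x_k$ in $Q$ has binary $h$-profile of type $(i_1,\dots,i_h)$. -}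

module Defs where

open import Data.Nat using (ℕ; zero; suc; _+_; _∸_; _^_; _≤_; _<_)
open import Data.Nat.DivMod using (_/_; _%_)
open import Data.Nat.Properties using (m^n≢0)
open import Data.Fin using (Fin; toℕ)
open import Data.Fin.Subset using (Subset; _∈_)
open import Data.Vec using (Vec; []; _∷_)
open import Data.Product using (Σ; ∃; _×_)
open import Relation.Binary.PropositionalEquality using (_≡_; _≢_)

-- i-th binary digit (1-indexed): t = Σ_j digit j t * 2^(j-1)
digit : ℕ → ℕ → ℕ
digit i t = _%_ (_/_ t (2 ^ (i ∸ 1)) {{m^n≢0 2 (i ∸ 1)}}) 2

IsM : ℕ → ℕ → ℕ → Set
IsM x y i = (1 ≤ i) × (digit i x ≢ digit i y) × (∀ j → i < j → digit j x ≡ digit j y)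

-- 1-indexed access into an h-tuple (default 0 out of range; only used in range)
at : ∀ {h} → Vec ℕ h → ℕ → ℕ
at [] _ = 0
at (x ∷ v) zero = 0
at (x ∷ v) (suc zero) = x
at (x ∷ v) (suc (suc r)) = at v (suc r)

ValidType : ∀ {h} → ℕ → Vec ℕ h → Set
ValidType {h} m iv =
  (∀ r → 1 ≤ r → r ≤ h → 1 ≤ at iv r × at iv r ≤ m) ×
  (∀ r → 1 ≤ r → r < h → at iv r < at iv (suc r))

HasProfile : ∀ {h} → ℕ → (ℕ → ℕ) → Vec ℕ h → Set
HasProfile {h} k xs iv =
  ∀ j → 1 ≤ j → j < k →
    Σ ℕ λ r → (IsM (j ∸ 1) j r) × (1 ≤ r) × (r ≤ h) × IsM (xs j) (xs (suc j)) (at iv r)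

-- iv ∈ bin-prof_h(Q), with n = 2^m, k = 2^h
InBinProf : ∀ {h} → (m : ℕ) → Subset (2 ^ m) → Vec ℕ h → Set
InBinProf {h} m Q iv =
  ValidType m iv ×
  Σ (ℕ → Fin (2 ^ m)) λ xs →
    (∀ j → 1 ≤ j → j ≤ 2 ^ h → xs j ∈ Q) ×
    (∀ j → 1 ≤ j → j < 2 ^ h → toℕ (xs j) < toℕ (xs (suc j))) ×
    HasProfile (2 ^ h) (λ j → toℕ (xs j)) iv

module Submission where

-- Write high a x = ⌊x / 2^a⌋ (x with its lowest a binary digits removed).  Then M(x,y) = i
-- exactly when high i x = high i y but high (i-1) x ≠ high (i-1) y; we call this "x and y
-- split at level i".  Let S be the elements of Q in increasing order.  For a level a let S_a
-- consist of the values high a u over the consecutive pairs (u,w) of S that split at level a.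
-- Reduction step: if x_1 < … < x_k in S realise the type (a, i_2, …, i_h), then the numbers
-- high a x_1, high a x_3, high a x_5, … lie in S_a and realise (i_2 - a, …, i_h - a), since the
-- steps 2t → 2t+1 of the index sequence 0,1,…,k-1 split at level 1 and the steps 2t+1 → 2t+2 at
-- level 1 + M(t,t+1).  Since T ↦ (tail T) - a is injective on types with head a, induction on h
-- bounds the number of types with head a by |S_a| ≤ #(consecutive pairs splitting at a), and
-- summing over a gives |bin-prof_h(Q)| ≤ #(consecutive pairs of S) = |Q| - 1.
-- The file develops: the arithmetic of `high` and of splits; consecutive pairs of sorted lists
-- and the level lists S_a; counting by levels; realisations and the reduction step; the
-- induction on h; and finally the translation from the definitions in Defs.

open import Defs
open import Data.Nat using (ℕ; zero; suc; pred; _+_; _*_; _∸_; _^_; _≤_; _<_; z≤n; s≤s; NonZero; _≟_; _≤?_)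
open import Data.Nat.Properties
open import Data.Nat.DivMod using (_/_; _%_; m≡m%n+[m/n]*n; /-monoˡ-≤; /-congʳ; m/n/o≡m/[n*o]; n/1≡n; m*n/n≡m; +-distrib-/; m*n%n≡0; m/n<m)
open import Data.Product using (Σ; _×_; _,_; proj₁; proj₂)
open import Data.Empty using (⊥-elim)
open import Data.Unit using (⊤; tt)
open import Data.Sum using (inj₁; inj₂)
open import Data.Bool using (true; false; if_then_else_)
open import Relation.Nullary using (¬_; Dec; yes; no; does)
open import Relation.Nullary.Decidable using (_×-dec_; ¬?)
open import Relation.Unary using (Decidable)
open import Relation.Binary.PropositionalEquality
open import Relation.Binary.Definitions using (tri<; tri≈; tri>)
open import Data.List using (List; []; _∷_; length; map; filter)
open import Data.List.Properties using (length-map)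
open import Data.List.Membership.Propositional using (_∈_)
open import Data.List.Membership.Propositional.Properties using (∈-filter⁺; ∈-map⁺; ∈-length)
open import Data.List.Relation.Unary.Any using (here; there)
open import Data.List.Relation.Unary.All as All using (All; []; _∷_)
import Data.List.Relation.Unary.All.Properties as AllP
open import Data.List.Relation.Unary.AllPairs as AllPairs using (AllPairs; []; _∷_)
import Data.List.Relation.Unary.AllPairs.Properties as AllPairsP
open import Data.List.Relation.Unary.Unique.Propositional using (Unique)
import Data.List.Relation.Unary.Unique.Propositional.Properties as UniqueP
open import Data.Vec as Vec using (Vec; []; _∷_)
open import Data.Fin using (Fin; toℕ; zero; suc)
open import Data.Fin.Subset as Subset using (Subset; Nonempty; ∣_∣)

high : ℕ → ℕ → ℕ
high a x = _/_ x (2 ^ a) {{m^n≢0 2 a}}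

high-zero : ∀ x → high 0 x ≡ x
high-zero x = n/1≡n x

high-+ : ∀ a c x → high (a + c) x ≡ high c (high a x)
high-+ a c x =
  trans (/-congʳ {m = x} {{m^n≢0 2 (a + c)}} {{nz}} (^-distribˡ-+-* 2 a c))
        (sym (m/n/o≡m/[n*o] x (2 ^ a) (2 ^ c) {{m^n≢0 2 a}} {{m^n≢0 2 c}} {{nz}}))
  where
  nz : NonZero (2 ^ a * 2 ^ c)
  nz = m*n≢0 (2 ^ a) (2 ^ c) {{m^n≢0 2 a}} {{m^n≢0 2 c}}

high-suc : ∀ a x → high (suc a) x ≡ high 1 (high a x)
high-suc a x = trans (cong (λ k → high k x) (+-comm 1 a)) (high-+ a 1 x)

high-split : ∀ {i j} x → i ≤ j → high j x ≡ high (j ∸ i) (high i x)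
high-split {i} {j} x i≤j = trans (cong (λ k → high k x) (sym (m+[n∸m]≡n i≤j))) (high-+ i (j ∸ i) x)

high-mono : ∀ a {x y} → x ≤ y → high a x ≤ high a y
high-mono a x≤y = /-monoˡ-≤ (2 ^ a) {{m^n≢0 2 a}} x≤y

high-agree-up : ∀ {i j x y} → i ≤ j → high i x ≡ high i y → high j x ≡ high j y
high-agree-up {i} {j} {x} {y} i≤j eq =
  trans (high-split x i≤j) (trans (cong (high (j ∸ i)) eq) (sym (high-split y i≤j)))

high-squeeze : ∀ a {x y z} → x ≤ z → z ≤ y → high a x ≡ high a y → high a z ≡ high a x
high-squeeze a x≤z z≤y eq =
  ≤-antisym (≤-trans (high-mono a z≤y) (≤-reflexive (sym eq))) (high-mono a x≤z)

half-even : ∀ t → high 1 (t * 2) ≡ t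
half-even t = m*n/n≡m t 2

half-odd : ∀ t → high 1 (suc (t * 2)) ≡ t
half-odd t = trans (+-distrib-/ 1 (t * 2) {2} no-carry) (m*n/n≡m t 2)
  where
  no-carry : 1 % 2 + (t * 2) % 2 < 2
  no-carry = subst (λ v → 1 % 2 + v < 2) (sym (m*n%n≡0 t 2)) (s≤s (s≤s z≤n))

half≤ : ∀ n x → x ≤ suc n → high 1 x ≤ n
half≤ n x x≤1+n = ≤-trans (high-mono 1 x≤1+n) (half-suc n)
  where
  half-suc : ∀ n → high 1 (suc n) ≤ n
  half-suc zero = z≤n
  half-suc (suc n) = ≤-pred (m/n<m (suc (suc n)) 2 (s≤s (s≤s z≤n)))

digit-high : ∀ i j x → 1 ≤ j → digit j (high i x) ≡ digit (i + j) x
digit-high i j x 1≤j =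
  cong (_% 2) (trans (sym (high-+ i (j ∸ 1) x)) (cong (λ k → high k x) (sym (+-∸-assoc i 1≤j))))

digits-determine : ∀ n x y → x ≤ n → y ≤ n → (∀ j → 1 ≤ j → digit j x ≡ digit j y) → x ≡ y
digits-determine zero .zero .zero z≤n z≤n _ = refl
digits-determine (suc n) x y x≤ y≤ same = begin
    x                      ≡⟨ m≡m%n+[m/n]*n x 2 ⟩
    x % 2 + high 1 x * 2   ≡⟨ cong₂ (λ u v → u + v * 2) lowest rest ⟩
    y % 2 + high 1 y * 2   ≡⟨ sym (m≡m%n+[m/n]*n y 2) ⟩
    y                      ∎
  where
  open ≡-Reasoning
  lowest : x % 2 ≡ y % 2
  lowest = trans (cong (_% 2) (sym (high-zero x)))
                 (trans (same 1 (s≤s z≤n)) (cong (_% 2) (high-zero y)))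
  rest : high 1 x ≡ high 1 y
  rest = digits-determine n (high 1 x) (high 1 y) (half≤ n x x≤) (half≤ n y y≤)
    λ j 1≤j → trans (digit-high 1 j x 1≤j) (trans (same (suc j) (s≤s z≤n)) (sym (digit-high 1 j y 1≤j)))

-- x and y split at level i: they agree above digit i but differ from digit i on.
-- This is the arithmetic form of M(x,y) = i.
Splits : ℕ → ℕ → ℕ → Set
Splits x y i = (1 ≤ i) × (high i x ≡ high i y) × (high (i ∸ 1) x ≢ high (i ∸ 1) y)

splits? : ∀ x y i → Dec (Splits x y i)
splits? x y i = (1 ≤? i) ×-dec (high i x ≟ high i y) ×-dec ¬? (high (i ∸ 1) x ≟ high (i ∸ 1) y)

IsM⇒Splits : ∀ {x y i} → IsM x y i → Splits x y i
IsM⇒Splits {x} {y} {i} (1≤i , differ , agree) = 1≤i , agree-above , λ eq → differ (cong (_% 2) eq)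
  where
  agree-above : high i x ≡ high i y
  agree-above = digits-determine (high i x + high i y) (high i x) (high i y) (m≤m+n _ _) (m≤n+m _ _)
    λ j 1≤j → trans (digit-high i j x 1≤j)
                (trans (agree (i + j) (≤-trans (≤-reflexive (+-comm 1 i)) (+-monoʳ-≤ i 1≤j)))
                       (sym (digit-high i j y 1≤j)))

Splits⇒IsM : ∀ {x y i} → Splits x y i → IsM x y i
Splits⇒IsM {x} {y} {suc i} (_ , agree , differ) = s≤s z≤n , digit-differs , digits-agree
  where
  -- if digit i+1 also agreed, agreement above level i+1 would extend down to level i
  digit-differs : digit (suc i) x ≢ digit (suc i) y
  digit-differs same = differ (begin
      high i x                                 ≡⟨ m≡m%n+[m/n]*n (high i x) 2 ⟩
      high i x % 2 + high 1 (high i x) * 2     ≡⟨ cong₂ (λ u v → u + v * 2) same above ⟩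
      high i y % 2 + high 1 (high i y) * 2     ≡⟨ sym (m≡m%n+[m/n]*n (high i y) 2) ⟩
      high i y                                 ∎)
    where
    open ≡-Reasoning
    above : high 1 (high i x) ≡ high 1 (high i y)
    above = trans (sym (high-suc i x)) (trans agree (high-suc i y))
  digits-agree : ∀ j → suc i < j → digit j x ≡ digit j y
  digits-agree (suc j) (s≤s i<j) = cong (_% 2) (high-agree-up i<j agree)

splits-unique : ∀ {x y r s} → Splits x y r → Splits x y s → r ≡ s
splits-unique {r = r} {s} (_ , agree-r , differ-r) (_ , agree-s , differ-s) with <-cmp r s
... | tri≈ _ r≡s _ = r≡s
... | tri< r<s _ _ = ⊥-elim (differ-s (high-agree-up (pred-mono-≤ r<s) agree-r))
... | tri> _ _ s<r = ⊥-elim (differ-r (high-agree-up (pred-mono-≤ s<r) agree-s))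

splits-differ-below : ∀ {x y a b} → Splits x y b → a < b → high a x ≢ high a y
splits-differ-below (_ , _ , differ) a<b eq = differ (high-agree-up (pred-mono-≤ a<b) eq)

splits-trans : ∀ {x y z a b} → Splits x y a → Splits y z b → a < b → Splits x z b
splits-trans (_ , agree-a , _) (1≤b , agree-b , differ-b) a<b =
  1≤b , trans (high-agree-up (<⇒≤ a<b) agree-a) agree-b ,
  λ eq → differ-b (trans (sym (high-agree-up (pred-mono-≤ a<b) agree-a)) eq)

splits-high : ∀ {x y a b} → Splits x y b → a < b → Splits (high a x) (high a y) (b ∸ a)
splits-high {x} {y} {a} {suc b} (_ , agree , differ) (s≤s a≤b) =
  subst (1 ≤_) (sym level) (s≤s z≤n) ,
  trans (sym (high-split x (m≤n⇒m≤1+n a≤b))) (trans agree (high-split y (m≤n⇒m≤1+n a≤b))) ,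
  λ eq → differ (trans (high-split x a≤b)
                  (trans (subst (λ k → high k (high a x) ≡ high k (high a y)) (cong pred level) eq)
                         (sym (high-split y a≤b))))
  where
  level : suc b ∸ a ≡ suc (b ∸ a)
  level = +-∸-assoc 1 a≤b

splits-even-step : ∀ t → Splits (t * 2) (suc (t * 2)) 1
splits-even-step t =
  s≤s z≤n , trans (half-even t) (sym (half-odd t)) ,
  λ eq → 1+n≢n (sym (trans (sym (high-zero (t * 2))) (trans eq (high-zero (suc (t * 2))))))

high-suc-odd : ∀ c t → high (suc c) (suc (t * 2)) ≡ high c t
high-suc-odd c t = trans (high-+ 1 c _) (cong (high c) (half-odd t))

high-suc-even : ∀ c t → high (suc c) (t * 2) ≡ high c t
high-suc-even c t = trans (high-+ 1 c _) (cong (high c) (half-even t))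

splits-odd-step : ∀ t r → Splits (suc (t * 2)) (suc t * 2) r → Σ ℕ λ r' → (r ≡ suc r') × Splits t (suc t) r'
splits-odd-step t (suc zero) (_ , agree , _) =
  ⊥-elim (1+n≢n (sym (trans (sym (half-odd t)) (trans agree (half-even (suc t))))))
splits-odd-step t (suc (suc r)) (_ , agree , differ) =
  suc r , refl , s≤s z≤n ,
  trans (sym (high-suc-odd (suc r) t)) (trans agree (high-suc-even (suc r) (suc t))) ,
  λ eq → differ (trans (high-suc-odd r t) (trans eq (sym (high-suc-even r (suc t)))))

Sorted : List ℕ → Set
Sorted = AllPairs _≤_

pairs : List ℕ → List (ℕ × ℕ)
pairs [] = []
pairs (u ∷ []) = []
pairs (u ∷ w ∷ r) = (u , w) ∷ pairs (w ∷ r)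

length-pairs : ∀ S → length (pairs S) ≡ length S ∸ 1
length-pairs [] = refl
length-pairs (u ∷ []) = refl
length-pairs (u ∷ w ∷ r) = cong suc (length-pairs (w ∷ r))

pairs-firsts : ∀ {P : ℕ → Set} S → All P S → All (λ p → P (proj₁ p)) (pairs S)
pairs-firsts [] _ = []
pairs-firsts (u ∷ []) _ = []
pairs-firsts (u ∷ w ∷ r) (pu ∷ ps) = pu ∷ pairs-firsts (w ∷ r) ps

pairs-sorted : ∀ S → Sorted S → AllPairs (λ p q → proj₁ p ≤ proj₁ q) (pairs S)
pairs-sorted [] _ = []
pairs-sorted (u ∷ []) _ = []
pairs-sorted (u ∷ w ∷ r) (u≤ ∷ sorted) = pairs-firsts (w ∷ r) u≤ ∷ pairs-sorted (w ∷ r) sorted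

crossing : ∀ {S} → Sorted S → (C : ℕ → Set) → (∀ w → Dec (C w)) → (∀ {u w} → u ≤ w → C w → C u) →
  ∀ {x y} → x ∈ S → y ∈ S → C x → ¬ C y →
  Σ (ℕ × ℕ) λ p → p ∈ pairs S × x ≤ proj₁ p × proj₂ p ≤ y × C (proj₁ p) × ¬ C (proj₂ p)
crossing (_ ∷ _) C C? closed (here refl) (here refl) cx ¬cy = ⊥-elim (¬cy cx)
crossing (s≤ ∷ _) C C? closed (there {xs = _ ∷ _} x∈) (here refl) cx ¬cy =
  ⊥-elim (¬cy (closed (All.lookup s≤ x∈) cx))
crossing (_ ∷ sorted) C C? closed (there {xs = _ ∷ _} x∈) (there y∈) cx ¬cy
  with p , p∈ , rest ← crossing sorted C C? closed x∈ y∈ cx ¬cy = p , there p∈ , rest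
crossing {s ∷ w ∷ _} (s≤ ∷ sorted) C C? closed (here refl) (there y∈) cx ¬cy with C? w
... | no ¬cw = (s , w) , here refl , ≤-refl , first≤ y∈ , cx , ¬cw
  where
  first≤ : ∀ {y} → y ∈ w ∷ _ → w ≤ y
  first≤ (here refl) = ≤-refl
  first≤ (there y∈) = All.lookup (AllPairs.head sorted) y∈
... | yes cw with p , p∈ , w≤ , rest ← crossing sorted C C? closed (here refl) y∈ cw ¬cy =
  p , there p∈ , ≤-trans (All.lookup s≤ (here refl)) w≤ , rest

splitting-pair : ∀ {S} → Sorted S → ∀ {x y a} → x ∈ S → y ∈ S → x < y → Splits x y a →
  Σ (ℕ × ℕ) λ p → p ∈ pairs S × Splits (proj₁ p) (proj₂ p) a × high a (proj₁ p) ≡ high a x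
splitting-pair sorted {x} {y} {suc a} x∈ y∈ x<y (_ , agree , differ)
  with (u , w) , p∈ , x≤u , w≤y , u-low , w-high ←
         crossing sorted (λ v → high a v ≤ high a x) (λ v → high a v ≤? high a x)
                  (λ u≤w c → ≤-trans (high-mono a u≤w) c) x∈ y∈ ≤-refl
                  (λ c → differ (≤-antisym (high-mono a (<⇒≤ x<y)) c))
  = (u , w) , p∈ , (s≤s z≤n , trans u-agrees (sym w-agrees) , λ eq → w-high (subst (_≤ high a x) eq u-low)) ,
    u-agrees
  where
  u-agrees : high (suc a) u ≡ high (suc a) x
  u-agrees = high-agree-up (n≤1+n a) (≤-antisym u-low (high-mono a x≤u))
  -- w ≤ x would contradict high a w > high a x
  x≤w : x ≤ w
  x≤w = ≮⇒≥ (λ w<x → w-high (high-mono a (<⇒≤ w<x)))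
  w-agrees : high (suc a) w ≡ high (suc a) x
  w-agrees = high-squeeze (suc a) x≤w w≤y agree

levelPairs : ℕ → List ℕ → List (ℕ × ℕ)
levelPairs a S = filter (λ p → splits? (proj₁ p) (proj₂ p) a) (pairs S)

levelList : ℕ → List ℕ → List ℕ
levelList a S = map (λ p → high a (proj₁ p)) (levelPairs a S)

levelList-sorted : ∀ a S → Sorted S → Sorted (levelList a S)
levelList-sorted a S sorted =
  AllPairsP.map⁺ (AllPairs.map (high-mono a) (AllPairsP.filter⁺ _ (pairs-sorted S sorted)))

levelList-∋ : ∀ a S → Sorted S → ∀ {x y} → x ∈ S → y ∈ S → x < y → Splits x y a → high a x ∈ levelList a S
levelList-∋ a S sorted x∈ y∈ x<y xy with p , p∈ , p-splits , same-high ← splitting-pair sorted x∈ y∈ x<y xy =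
  subst (_∈ levelList a S) same-high (∈-map⁺ (λ p → high a (proj₁ p)) (∈-filter⁺ _ p∈ p-splits))

sumTo : ℕ → (ℕ → ℕ) → ℕ
sumTo zero f = 0
sumTo (suc B) f = f (suc B) + sumTo B f

sumTo-cong : ∀ B {f g : ℕ → ℕ} → (∀ a → f a ≡ g a) → sumTo B f ≡ sumTo B g
sumTo-cong zero _ = refl
sumTo-cong (suc B) f≡g = cong₂ _+_ (f≡g (suc B)) (sumTo-cong B f≡g)

sumTo-+ : ∀ B f g → sumTo B (λ a → f a + g a) ≡ sumTo B f + sumTo B g
sumTo-+ zero f g = refl
sumTo-+ (suc B) f g = begin
    (f (suc B) + g (suc B)) + sumTo B (λ a → f a + g a)   ≡⟨ cong ((f (suc B) + g (suc B)) +_) (sumTo-+ B f g) ⟩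
    (f (suc B) + g (suc B)) + (sumTo B f + sumTo B g)     ≡⟨ +-assoc (f (suc B)) (g (suc B)) _ ⟩
    f (suc B) + (g (suc B) + (sumTo B f + sumTo B g))     ≡⟨ cong (f (suc B) +_) (x+[y+z]≡y+[x+z] (g (suc B)) (sumTo B f) _) ⟩
    f (suc B) + (sumTo B f + (g (suc B) + sumTo B g))     ≡⟨ sym (+-assoc (f (suc B)) (sumTo B f) _) ⟩
    (f (suc B) + sumTo B f) + (g (suc B) + sumTo B g)     ∎
  where
  open ≡-Reasoning
  x+[y+z]≡y+[x+z] : ∀ x y z → x + (y + z) ≡ y + (x + z)
  x+[y+z]≡y+[x+z] x y z = trans (sym (+-assoc x y z)) (trans (cong (_+ z) (+-comm x y)) (+-assoc y x z))

sumTo-mono : ∀ B {f g} → (∀ a → f a ≤ g a) → sumTo B f ≤ sumTo B g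
sumTo-mono zero _ = z≤n
sumTo-mono (suc B) f≤g = +-mono-≤ (f≤g (suc B)) (sumTo-mono B f≤g)

module CountByLevel {X : Set} (HasLevel : ℕ → X → Set) (hasLevel? : ∀ a → Decidable (HasLevel a)) where

  count : ℕ → List X → ℕ
  count a L = length (filter (hasLevel? a) L)

  indicator : ℕ → X → ℕ
  indicator a x = if does (hasLevel? a x) then 1 else 0

  levels : ℕ → X → ℕ
  levels B x = sumTo B (λ a → indicator a x)

  count-∷ : ∀ a x L → count a (x ∷ L) ≡ indicator a x + count a L
  count-∷ a x L with does (hasLevel? a x)
  ... | true = refl
  ... | false = refl

  counts-∷ : ∀ B x L → sumTo B (λ a → count a (x ∷ L)) ≡ levels B x + sumTo B (λ a → count a L)
  counts-∷ B x L = trans (sumTo-cong B (λ a → count-∷ a x L)) (sumTo-+ B (λ a → indicator a x) _)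

  counts-[] : ∀ B → sumTo B (λ a → count a []) ≡ 0
  counts-[] zero = refl
  counts-[] (suc B) = counts-[] B

  levels-none : ∀ B x → (∀ a → a ≤ B → ¬ HasLevel a x) → levels B x ≡ 0
  levels-none zero x _ = refl
  levels-none (suc B) x none with hasLevel? (suc B) x
  ... | yes has = ⊥-elim (none (suc B) ≤-refl has)
  ... | no _ = levels-none B x (λ a a≤B → none a (m≤n⇒m≤1+n a≤B))

  levels≤1 : ∀ B x → (∀ a b → HasLevel a x → HasLevel b x → a ≡ b) → levels B x ≤ 1
  levels≤1 zero x _ = z≤n
  levels≤1 (suc B) x unique with hasLevel? (suc B) x
  ... | yes has = ≤-reflexive (cong suc (levels-none B x
                    (λ a a≤B has-a → <-irrefl (unique a (suc B) has-a has) (s≤s a≤B))))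
  ... | no _ = levels≤1 B x unique

  levels≥1 : ∀ B x a → 1 ≤ a → a ≤ B → HasLevel a x → 1 ≤ levels B x
  levels≥1 zero x (suc a) 1≤a () has
  levels≥1 (suc B) x a 1≤a a≤1+B has with hasLevel? (suc B) x
  ... | yes _ = s≤s z≤n
  ... | no ¬has with m≤n⇒m<n∨m≡n a≤1+B
  ...   | inj₁ a<1+B = levels≥1 B x a 1≤a (≤-pred a<1+B) has
  ...   | inj₂ refl = ⊥-elim (¬has has)

  counts≤length : ∀ B → (∀ a b x → HasLevel a x → HasLevel b x → a ≡ b) → ∀ L →
    sumTo B (λ a → count a L) ≤ length L
  counts≤length B _ [] = ≤-reflexive (counts-[] B)
  counts≤length B unique (x ∷ L) =
    ≤-trans (≤-reflexive (counts-∷ B x L)) (+-mono-≤ (levels≤1 B x (λ a b → unique a b x)) (counts≤length B unique L))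

  length≤counts : ∀ B L → All (λ x → Σ ℕ λ a → 1 ≤ a × a ≤ B × HasLevel a x) L →
    length L ≤ sumTo B (λ a → count a L)
  length≤counts B [] [] = z≤n
  length≤counts B (x ∷ L) ((a , 1≤a , a≤B , has) ∷ rest) =
    ≤-trans (+-mono-≤ (levels≥1 B x a 1≤a a≤B has) (length≤counts B L rest)) (≤-reflexive (sym (counts-∷ B x L)))

Increasing : ∀ {h} → ℕ → ℕ → Vec ℕ h → Set
Increasing lo B [] = ⊤
Increasing lo B (x ∷ v) = lo < x × x ≤ B × Increasing x B v

Increasing-at : ∀ {h lo B} (v : Vec ℕ h) → Increasing lo B v → ∀ r → 1 ≤ r → r ≤ h → lo < at v r × at v r ≤ B
Increasing-at (x ∷ v) (lo<x , x≤B , _) (suc zero) _ _ = lo<x , x≤B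
Increasing-at (x ∷ v) (lo<x , _ , inc) (suc (suc r)) _ (s≤s r<h)
  with x<vr , vr≤B ← Increasing-at v inc (suc r) (s≤s z≤n) r<h = <-trans lo<x x<vr , vr≤B

shiftDown : ∀ {h} → ℕ → Vec ℕ h → Vec ℕ h
shiftDown a = Vec.map (_∸ a)

at-shiftDown : ∀ {h} a (v : Vec ℕ h) r → at (shiftDown a v) r ≡ at v r ∸ a
at-shiftDown a [] r = sym (0∸n≡0 a)
at-shiftDown a (x ∷ v) zero = sym (0∸n≡0 a)
at-shiftDown a (x ∷ v) (suc zero) = refl
at-shiftDown a (x ∷ v) (suc (suc r)) = at-shiftDown a v (suc r)

Increasing-shiftDown : ∀ {h lo B a} (v : Vec ℕ h) → a ≤ lo → Increasing lo B v → Increasing (lo ∸ a) B (shiftDown a v)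
Increasing-shiftDown [] _ _ = tt
Increasing-shiftDown {a = a} (x ∷ v) a≤lo (lo<x , x≤B , inc) =
  ∸-monoˡ-< lo<x a≤lo , ≤-trans (m∸n≤m x a) x≤B , Increasing-shiftDown v (≤-trans a≤lo (<⇒≤ lo<x)) inc

shiftDown-injective : ∀ {h lo lo' B a} (v w : Vec ℕ h) → Increasing lo B v → Increasing lo' B w → a ≤ lo → a ≤ lo' →
  shiftDown a v ≡ shiftDown a w → v ≡ w
shiftDown-injective [] [] _ _ _ _ _ = refl
shiftDown-injective (x ∷ v) (y ∷ w) (lo<x , _ , inc) (lo'<y , _ , inc') a≤lo a≤lo' eq =
  cong₂ _∷_ (∸-cancelʳ-≡ a≤x a≤y (cong Vec.head eq)) (shiftDown-injective v w inc inc' a≤x a≤y (cong Vec.tail eq))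
  where
  a≤x = ≤-trans a≤lo (<⇒≤ lo<x)
  a≤y = ≤-trans a≤lo' (<⇒≤ lo'<y)

RealisedIn : (h : ℕ) → List ℕ → Vec ℕ h → Set
RealisedIn h S T = Σ (ℕ → ℕ) λ xs →
  (∀ j → 1 ≤ j → j ≤ 2 ^ h → xs j ∈ S) ×
  (∀ j → 1 ≤ j → j < 2 ^ h → xs j < xs (suc j)) ×
  HasProfile (2 ^ h) xs T

double-≤ : ∀ {t K} → t ≤ K → t * 2 ≤ 2 * K
double-≤ {t} {K} t≤K = subst (t * 2 ≤_) (*-comm K 2) (*-monoˡ-≤ 2 t≤K)

-- Reduction step: if (a ∷ T) is realised in S by x_1 < … < x_{2K}, then T - a is realised in the
-- level list S_a by the numbers high a x_1, high a x_3, …, high a x_{2K-1}.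
reduce : ∀ h S → Sorted S → ∀ a B (T : Vec ℕ h) → Increasing a B T →
  RealisedIn (suc h) S (a ∷ T) → RealisedIn h (levelList a S) (shiftDown a T)
reduce h S sorted a B T inc (xs , xs∈ , xs< , profile) = zs , zs∈ , zs< , zs-profile
  where
  -- x_{2t+1} and x_{2t+2} split at level a, since the step 2t → 2t+1 splits at level 1
  odd-pair : ∀ t → suc t ≤ 2 ^ h → Splits (xs (suc (t * 2))) (xs (suc t * 2)) a
  odd-pair t t<K with profile (suc (t * 2)) (s≤s z≤n) (double-≤ t<K)
  ... | r , step , _ , _ , xs-step with splits-unique (IsM⇒Splits step) (splits-even-step t)
  ...   | refl = IsM⇒Splits xs-step

  -- x_{2t+1} and x_{2t+3} split at level b = T_r > a, where r = M(t, t+1)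
  skip-pair : ∀ t → suc (suc t) ≤ 2 ^ h →
    Σ ℕ λ r → IsM t (suc t) r × 1 ≤ r × r ≤ h × a < at T r ×
              Splits (xs (suc (t * 2))) (xs (suc (suc t * 2))) (at T r)
  skip-pair t t+1<K with profile (suc t * 2) (s≤s z≤n) (≤-trans (n≤1+n _) (double-≤ t+1<K))
  ... | r , step , _ , r≤1+h , xs-step with splits-odd-step t r (IsM⇒Splits step)
  ...   | suc r' , refl , step' = suc r' , Splits⇒IsM step' , s≤s z≤n , ≤-pred r≤1+h , a<b ,
          splits-trans (odd-pair t (≤-trans (n≤1+n _) t+1<K)) (IsM⇒Splits xs-step) a<b
    where
    a<b : a < at T (suc r')
    a<b = proj₁ (Increasing-at T inc (suc r') (s≤s z≤n) (≤-pred r≤1+h))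

  zs : ℕ → ℕ
  zs zero = 0
  zs (suc t) = high a (xs (suc (t * 2)))

  zs∈ : ∀ j → 1 ≤ j → j ≤ 2 ^ h → zs j ∈ levelList a S
  zs∈ (suc t) _ t<K = levelList-∋ a S sorted (xs∈ _ (s≤s z≤n) (≤-trans (n≤1+n _) (double-≤ t<K)))
                        (xs∈ _ (s≤s z≤n) (double-≤ t<K)) (xs< _ (s≤s z≤n) (double-≤ t<K)) (odd-pair t t<K)

  zs< : ∀ j → 1 ≤ j → j < 2 ^ h → zs j < zs (suc j)
  zs< (suc t) _ t+1<K with _ , _ , _ , _ , a<b , skip ← skip-pair t t+1<K =
    ≤∧≢⇒< (high-mono a (<⇒≤ (<-trans (xs< _ (s≤s z≤n) 2t+1<2K) (xs< _ (s≤s z≤n) 2t+2<2K))))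
          (splits-differ-below skip a<b)
    where
    2t+2<2K : suc t * 2 < 2 ^ suc h
    2t+2<2K = ≤-trans (n≤1+n _) (double-≤ t+1<K)
    2t+1<2K : suc (t * 2) < 2 ^ suc h
    2t+1<2K = <-trans (n<1+n _) 2t+2<2K

  zs-profile : HasProfile (2 ^ h) zs (shiftDown a T)
  zs-profile (suc t) _ t+1<K with r , step , 1≤r , r≤h , a<b , skip ← skip-pair t t+1<K =
    r , step , 1≤r , r≤h ,
    subst (IsM (zs (suc t)) (zs (suc (suc t)))) (sym (at-shiftDown a T r)) (Splits⇒IsM (splits-high skip a<b))

map-unique : ∀ {A C : Set} {P : A → Set} (f : A → C) → (∀ {x y} → P x → P y → f x ≡ f y → x ≡ y) →
  ∀ {L} → All P L → Unique L → Unique (map f L)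
map-unique f injective [] [] = []
map-unique {P = P} f injective {x ∷ L} (px ∷ pL) (x∉L ∷ unique) = AllP.map⁺ (images-differ pL x∉L) ∷ map-unique f injective pL unique
  where
  images-differ : ∀ {L} → All P L → All (x ≢_) L → All (λ y → f x ≢ f y) L
  images-differ [] [] = []
  images-differ (py ∷ pL) (x≢y ∷ rest) = (λ eq → x≢y (injective px py eq)) ∷ images-differ pL rest

Candidate : (h : ℕ) → ℕ → List ℕ → Vec ℕ h → Set
Candidate h B S T = Increasing 0 B T × RealisedIn h S T

lower : ∀ {h} → ℕ → Vec ℕ (suc h) → Vec ℕ h
lower a T = shiftDown a (Vec.tail T)

lower-candidate : ∀ h B S → Sorted S → ∀ a (T : Vec ℕ (suc h)) → Vec.head T ≡ a × Candidate (suc h) B S T →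
  Candidate h B (levelList a S) (lower a T)
lower-candidate h B S sorted a (a ∷ T) (refl , (_ , _ , inc) , realised) =
  subst (λ lo → Increasing lo B (shiftDown a T)) (n∸n≡0 a) (Increasing-shiftDown T ≤-refl inc) ,
  reduce h S sorted a B T inc realised

lower-injective : ∀ h B S a {T U : Vec ℕ (suc h)} → Vec.head T ≡ a × Candidate (suc h) B S T →
  Vec.head U ≡ a × Candidate (suc h) B S U → lower a T ≡ lower a U → T ≡ U
lower-injective h B S a {a ∷ T} {a ∷ U} (refl , (_ , _ , inc-T) , _) (refl , (_ , _ , inc-U) , _) eq =
  cong (a ∷_) (shiftDown-injective T U inc-T inc-U ≤-refl ≤-refl eq)

module ByHead {h : ℕ} = CountByLevel {Vec ℕ (suc h)} (λ a T → Vec.head T ≡ a) (λ a T → Vec.head T ≟ a)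
module ByLevel = CountByLevel {ℕ × ℕ} (λ a p → Splits (proj₁ p) (proj₂ p) a) (λ a p → splits? (proj₁ p) (proj₂ p) a)

mutual
  candidates-bound : ∀ h B S → Sorted S → (L : List (Vec ℕ (suc h))) → Unique L →
    All (Candidate (suc h) B S) L → length L ≤ length S ∸ 1
  candidates-bound h B S sorted L unique cand = begin
      length L                                       ≤⟨ ByHead.length≤counts B L (All.map head-in-range cand) ⟩
      sumTo B (λ a → ByHead.count a L)               ≤⟨ sumTo-mono B (λ a → candidates-with-head-bound h B S sorted a L unique cand) ⟩
      sumTo B (λ a → ByLevel.count a (pairs S))      ≤⟨ ByLevel.counts≤length B (λ _ _ _ → splits-unique) (pairs S) ⟩
      length (pairs S)                               ≡⟨ length-pairs S ⟩
      length S ∸ 1                                   ∎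
    where
    open ≤-Reasoning
    head-in-range : ∀ {T} → Candidate (suc h) B S T → Σ ℕ λ a → 1 ≤ a × a ≤ B × Vec.head T ≡ a
    head-in-range {x ∷ _} ((0<x , x≤B , _) , _) = x , 0<x , x≤B , refl

  candidates-with-head-bound : ∀ h B S → Sorted S → ∀ a (L : List (Vec ℕ (suc h))) → Unique L →
    All (Candidate (suc h) B S) L → ByHead.count a L ≤ length (levelPairs a S)
  candidates-with-head-bound h B S sorted a L unique cand = begin
      length La                     ≡⟨ sym (length-map (lower a) La) ⟩
      length (map (lower a) La)     ≤⟨ candidates-bound₀ h B (levelList a S) (levelList-sorted a S sorted) (map (lower a) La)
                                         (map-unique (lower a) (lower-injective h B S a) headed (UniqueP.filter⁺ head? unique))
                                         (AllP.map⁺ (All.map (lower-candidate h B S sorted a _) headed)) ⟩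
      length (levelList a S)        ≡⟨ length-map _ (levelPairs a S) ⟩
      length (levelPairs a S)       ∎
    where
    open ≤-Reasoning
    head? : Decidable (λ (T : Vec ℕ (suc h)) → Vec.head T ≡ a)
    head? T = Vec.head T ≟ a
    La = filter head? L
    headed : All (λ T → Vec.head T ≡ a × Candidate (suc h) B S T) La
    headed = All.zip (AllP.all-filter head? L , AllP.filter⁺ head? cand)

  candidates-bound₀ : ∀ h B S → Sorted S → (L : List (Vec ℕ h)) → Unique L →
    All (Candidate h B S) L → length L ≤ length S
  candidates-bound₀ zero B S sorted [] _ _ = z≤n
  candidates-bound₀ zero B S sorted ([] ∷ []) _ ((_ , _ , xs∈ , _) ∷ []) = ∈-length (xs∈ 1 (s≤s z≤n) (s≤s z≤n))
  candidates-bound₀ zero B S sorted ([] ∷ [] ∷ _) ((distinct ∷ _) ∷ _) _ = ⊥-elim (distinct refl)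
  candidates-bound₀ (suc h) B S sorted L unique cand = ≤-trans (candidates-bound h B S sorted L unique cand) (m∸n≤m _ 1)

elements : ∀ {n} → Subset n → List ℕ
elements [] = []
elements (true ∷ p) = 0 ∷ map suc (elements p)
elements (false ∷ p) = map suc (elements p)

elements-length : ∀ {n} (p : Subset n) → length (elements p) ≡ ∣ p ∣
elements-length [] = refl
elements-length (true ∷ p) = cong suc (trans (length-map suc (elements p)) (elements-length p))
elements-length (false ∷ p) = trans (length-map suc (elements p)) (elements-length p)

elements-sorted : ∀ {n} (p : Subset n) → Sorted (elements p)
elements-sorted [] = []
elements-sorted (true ∷ p) = All.universal (λ _ → z≤n) _ ∷ AllPairsP.map⁺ (AllPairs.map s≤s (elements-sorted p))
elements-sorted (false ∷ p) = AllPairsP.map⁺ (AllPairs.map s≤s (elements-sorted p))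

elements-∋ : ∀ {n} (p : Subset n) (i : Fin n) → i Subset.∈ p → toℕ i ∈ elements p
elements-∋ (true ∷ p) zero Vec.here = here refl
elements-∋ (true ∷ p) (suc i) (Vec.there i∈) = there (∈-map⁺ suc (elements-∋ p i i∈))
elements-∋ (false ∷ p) (suc i) (Vec.there i∈) = ∈-map⁺ suc (elements-∋ p i i∈)

ValidType⇒Increasing : ∀ {h} m (v : Vec ℕ h) lo → (∀ r → 1 ≤ r → r ≤ h → at v r ≤ m) →
  (∀ r → 1 ≤ r → r < h → at v r < at v (suc r)) → (1 ≤ h → lo < at v 1) → Increasing lo m v
ValidType⇒Increasing m [] lo _ _ _ = tt
ValidType⇒Increasing m (x ∷ w) lo bounded increasing lo<x =
  lo<x (s≤s z≤n) , bounded 1 (s≤s z≤n) (s≤s z≤n) ,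
  ValidType⇒Increasing m w x (λ { (suc r) _ r≤h → bounded (suc (suc r)) (s≤s z≤n) (s≤s r≤h) })
                             (λ { (suc r) _ r<h → increasing (suc (suc r)) (s≤s z≤n) (s≤s r<h) })
                             (λ 1≤h → increasing 1 (s≤s z≤n) (s≤s 1≤h))

InBinProf⇒Candidate : ∀ {h} m (Q : Subset (2 ^ m)) (T : Vec ℕ h) → InBinProf m Q T → Candidate h m (elements Q) T
InBinProf⇒Candidate m Q T ((in-range , increasing) , xs , xs∈ , xs< , profile) =
  ValidType⇒Increasing m T 0 (λ r 1≤r r≤h → proj₂ (in-range r 1≤r r≤h)) increasing
                             (λ 1≤h → proj₁ (in-range 1 (s≤s z≤n) 1≤h)) ,
  (λ j → toℕ (xs j)) , (λ j 1≤j j≤k → elements-∋ Q (xs j) (xs∈ j 1≤j j≤k)) , xs< , profile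

lemma4p9 : (h m : ℕ) → 1 ≤ h → h ≤ m → (Q : Subset (2 ^ m)) → Nonempty Q →
    (L : List (Vec ℕ h)) → Unique L → All (InBinProf m Q) L →
    length L ≤ ∣ Q ∣ ∸ 1
lemma4p9 (suc h) m _ _ Q _ L unique in-prof =
  subst (λ size → length L ≤ size ∸ 1) (elements-length Q)
    (candidates-bound h m (elements Q) (elements-sorted Q) L unique
      (All.map (InBinProf⇒Candidate m Q _) in-prof))
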